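{- Let $a,b\in\mathbb Z$ with $4a^3+27b^2\neq0$, let $t=(x_t,y_t)$ be an integer solution of $y^2=x^3+ax+b$, and let $Q=u^4-6x_tu^2v^2-8y_tuv^3-(3x_t^2+4a)v^4$. Then $H(Y_{a,b})=H(Q)$, where $H(Y_{a,b})=\max\{2^{12}3^4|a|^3,\ 2^{14}3^{12}b^2\}$ and, for a binary quartic $Q=c_0u^4+c_1u^3v+c_2u^2v^2+c_3uv^3+c_4v^4$, $H(Q)=\max\{2^63^4|J_2|^3,\ 2^{10}3^{12}J_3^2\}$ with $$J_2=\tfrac1{12}c_2^2-\tfrac14c_1c_3+c_0c_4,\qquad J_3=\tfrac1{216}c_2^3-\tfrac1{48}c_1c_2c_3+\tfrac1{16}c_0c_3^2+\tfrac1{16}c_1^2c_4-\tfrac16c_0c_2c_4.$$ -}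

module Defs where

open import Data.Nat using (ℕ)
open import Data.Integer as ℤ using (ℤ; +_)
open import Data.Rational using (ℚ; _+_; _-_; _*_; -_; _/_; ∣_∣; _⊔_)

⟦_⟧ : ℤ → ℚ
⟦ n ⟧ = n / 1

κ : (n d : ℕ) → .{{_ : Data.Nat.NonZero d}} → ℚ
κ n d = (+ n) / d

sq : ℚ → ℚ
sq q = q * q

cube : ℚ → ℚ
cube q = q * q * q

record BinaryQuartic : Set where
  constructor quartic
  field
    c₀ c₁ c₂ c₃ c₄ : ℤ

open BinaryQuartic public

J₂ : BinaryQuartic → ℚ
J₂ Q = κ 1 12 * sq ⟦ c₂ Q ⟧ - κ 1 4 * ⟦ c₁ Q ⟧ * ⟦ c₃ Q ⟧ + ⟦ c₀ Q ⟧ * ⟦ c₄ Q ⟧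

J₃ : BinaryQuartic → ℚ
J₃ Q = κ 1 216 * cube ⟦ c₂ Q ⟧
     - κ 1 48 * ⟦ c₁ Q ⟧ * ⟦ c₂ Q ⟧ * ⟦ c₃ Q ⟧
     + κ 1 16 * ⟦ c₀ Q ⟧ * sq ⟦ c₃ Q ⟧
     + κ 1 16 * sq ⟦ c₁ Q ⟧ * ⟦ c₄ Q ⟧
     - κ 1 6 * ⟦ c₀ Q ⟧ * ⟦ c₂ Q ⟧ * ⟦ c₄ Q ⟧

H-quartic : BinaryQuartic → ℚ
H-quartic Q = (κ (2 Data.Nat.^ 6 Data.Nat.* 3 Data.Nat.^ 4) 1 * cube ∣ J₂ Q ∣)
            ⊔ (κ (2 Data.Nat.^ 10 Data.Nat.* 3 Data.Nat.^ 12) 1 * sq (J₃ Q))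

H-curve : ℤ → ℤ → ℚ
H-curve a b = (κ (2 Data.Nat.^ 12 Data.Nat.* 3 Data.Nat.^ 4) 1 * cube ∣ ⟦ a ⟧ ∣)
            ⊔ (κ (2 Data.Nat.^ 14 Data.Nat.* 3 Data.Nat.^ 12) 1 * sq ⟦ b ⟧)

quarticOf : (a x y : ℤ) → BinaryQuartic
quarticOf a x y = quartic (+ 1) (+ 0) (ℤ.- (+ 6 ℤ.* x)) (ℤ.- (+ 8 ℤ.* y))
                          (ℤ.- (+ 3 ℤ.* x ℤ.* x ℤ.+ + 4 ℤ.* a))

-- Read off the two quartic invariants directly: for Q = u⁴ − 6xu²v² − 8yuv³ − (3x² + 4a)v⁴ one has
-- J₂(Q) = −4a identically and J₃(Q) = 4(y² − x³ − ax), which is 4b on the curve. Since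
-- 2⁶3⁴·4³ = 2¹²3⁴ and 2¹⁰3¹²·4² = 2¹⁴3¹², the two heights then agree term by term.
{-# OPTIONS --safe #-}
module Submission where

open import Defs
open import Data.Integer using (ℤ; +_)
open import Relation.Binary.PropositionalEquality using (_≡_; _≢_; sym)

module Invariants where

  open import Data.Nat as ℕ using ()
  open import Data.Nat.Coprimality as Coprimality using (1-coprimeTo)
  import Data.Integer as ℤ
  import Data.Integer.Properties as ℤ
  open import Data.Rational using (mkℚ; _+_; _-_; _*_; -_; ∣_∣; _⊔_)
  open import Data.Rational.Properties using (↥p/↧p≡p; ∣-p∣≡∣p∣; ∣p*q∣≡∣p∣*∣q∣)
  open import Data.Rational.Solver using (module +-*-Solver)
  open +-*-Solver using (solve; con; _:+_; _:-_; _:*_; :-_; _:=_)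
  open import Relation.Binary.PropositionalEquality
  open ≡-Reasoning

  -- In lowest terms n / 1 is mkℚ n 0 _, on which ℚ's _+_ and _*_ reduce to those of ℤ.
  ⟦⟧-canonical : ∀ n → ⟦ n ⟧ ≡ mkℚ n 0 (Coprimality.sym (1-coprimeTo ℤ.∣ n ∣))
  ⟦⟧-canonical n = ↥p/↧p≡p (mkℚ n 0 (Coprimality.sym (1-coprimeTo ℤ.∣ n ∣)))

  ⟦⟧-homo-+ : ∀ m n → ⟦ m ℤ.+ n ⟧ ≡ ⟦ m ⟧ + ⟦ n ⟧
  ⟦⟧-homo-+ m n rewrite ⟦⟧-canonical m | ⟦⟧-canonical n =
    sym (cong₂ (λ i j → ⟦ i ℤ.+ j ⟧) (ℤ.*-identityʳ m) (ℤ.*-identityʳ n))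

  ⟦⟧-homo-* : ∀ m n → ⟦ m ℤ.* n ⟧ ≡ ⟦ m ⟧ * ⟦ n ⟧
  ⟦⟧-homo-* m n rewrite ⟦⟧-canonical m | ⟦⟧-canonical n = refl

  ⟦⟧-homo‿- : ∀ n → ⟦ ℤ.- n ⟧ ≡ - ⟦ n ⟧
  ⟦⟧-homo‿- n rewrite ⟦⟧-canonical n | ⟦⟧-canonical (ℤ.- n) = canonical-homo‿- n
    where
    canonical-homo‿- : ∀ n → mkℚ (ℤ.- n) 0 (Coprimality.sym (1-coprimeTo ℤ.∣ ℤ.- n ∣))
                            ≡ - mkℚ n 0 (Coprimality.sym (1-coprimeTo ℤ.∣ n ∣))
    canonical-homo‿- (+ 0)      = refl
    canonical-homo‿- ℤ.+[1+ _ ] = refl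
    canonical-homo‿- ℤ.-[1+ _ ] = refl

  ⟦c₂⟧-quarticOf : ∀ x → ⟦ ℤ.- (+ 6 ℤ.* x) ⟧ ≡ - (⟦ + 6 ⟧ * ⟦ x ⟧)
  ⟦c₂⟧-quarticOf x = trans (⟦⟧-homo‿- (+ 6 ℤ.* x)) (cong -_ (⟦⟧-homo-* (+ 6) x))

  ⟦c₃⟧-quarticOf : ∀ y → ⟦ ℤ.- (+ 8 ℤ.* y) ⟧ ≡ - (⟦ + 8 ⟧ * ⟦ y ⟧)
  ⟦c₃⟧-quarticOf y = trans (⟦⟧-homo‿- (+ 8 ℤ.* y)) (cong -_ (⟦⟧-homo-* (+ 8) y))

  ⟦c₄⟧-quarticOf : ∀ a x →
    ⟦ ℤ.- (+ 3 ℤ.* x ℤ.* x ℤ.+ + 4 ℤ.* a) ⟧ ≡ - (⟦ + 3 ⟧ * ⟦ x ⟧ * ⟦ x ⟧ + ⟦ + 4 ⟧ * ⟦ a ⟧)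
  ⟦c₄⟧-quarticOf a x = begin
    ⟦ ℤ.- (+ 3 ℤ.* x ℤ.* x ℤ.+ + 4 ℤ.* a) ⟧           ≡⟨ ⟦⟧-homo‿- (+ 3 ℤ.* x ℤ.* x ℤ.+ + 4 ℤ.* a) ⟩
    - ⟦ + 3 ℤ.* x ℤ.* x ℤ.+ + 4 ℤ.* a ⟧               ≡⟨ cong -_ (⟦⟧-homo-+ (+ 3 ℤ.* x ℤ.* x) (+ 4 ℤ.* a)) ⟩
    - (⟦ + 3 ℤ.* x ℤ.* x ⟧ + ⟦ + 4 ℤ.* a ⟧)           ≡⟨ cong -_ (cong₂ _+_ 3xx (⟦⟧-homo-* (+ 4) a)) ⟩
    - (⟦ + 3 ⟧ * ⟦ x ⟧ * ⟦ x ⟧ + ⟦ + 4 ⟧ * ⟦ a ⟧)     ∎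
    where
    3xx : ⟦ + 3 ℤ.* x ℤ.* x ⟧ ≡ ⟦ + 3 ⟧ * ⟦ x ⟧ * ⟦ x ⟧
    3xx = trans (⟦⟧-homo-* (+ 3 ℤ.* x) x) (cong (_* ⟦ x ⟧) (⟦⟧-homo-* (+ 3) x))

  J₂-quarticOf : ∀ a x y → J₂ (quarticOf a x y) ≡ - (⟦ + 4 ⟧ * ⟦ a ⟧)
  J₂-quarticOf a x y
    rewrite ⟦c₂⟧-quarticOf x | ⟦c₃⟧-quarticOf y | ⟦c₄⟧-quarticOf a x
    = solve 3 (λ X Y A →
          con (κ 1 12) :* ((:- (con ⟦ + 6 ⟧ :* X)) :* (:- (con ⟦ + 6 ⟧ :* X)))
       :- con (κ 1 4) :* con ⟦ + 0 ⟧ :* (:- (con ⟦ + 8 ⟧ :* Y))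
       :+ con ⟦ + 1 ⟧ :* (:- (con ⟦ + 3 ⟧ :* X :* X :+ con ⟦ + 4 ⟧ :* A))
       := :- (con ⟦ + 4 ⟧ :* A)) refl ⟦ x ⟧ ⟦ y ⟧ ⟦ a ⟧

  J₃-quarticOf : ∀ a x y →
    J₃ (quarticOf a x y) ≡ ⟦ + 4 ⟧ * (⟦ y ⟧ * ⟦ y ⟧ - (cube ⟦ x ⟧ + ⟦ a ⟧ * ⟦ x ⟧))
  J₃-quarticOf a x y
    rewrite ⟦c₂⟧-quarticOf x | ⟦c₃⟧-quarticOf y | ⟦c₄⟧-quarticOf a x
    = solve 3 (λ X Y A →
          con (κ 1 216) :* ((:- (con ⟦ + 6 ⟧ :* X)) :* (:- (con ⟦ + 6 ⟧ :* X)) :* (:- (con ⟦ + 6 ⟧ :* X)))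
       :- con (κ 1 48) :* con ⟦ + 0 ⟧ :* (:- (con ⟦ + 6 ⟧ :* X)) :* (:- (con ⟦ + 8 ⟧ :* Y))
       :+ con (κ 1 16) :* con ⟦ + 1 ⟧ :* ((:- (con ⟦ + 8 ⟧ :* Y)) :* (:- (con ⟦ + 8 ⟧ :* Y)))
       :+ con (κ 1 16) :* (con ⟦ + 0 ⟧ :* con ⟦ + 0 ⟧) :* (:- (con ⟦ + 3 ⟧ :* X :* X :+ con ⟦ + 4 ⟧ :* A))
       :- con (κ 1 6) :* con ⟦ + 1 ⟧ :* (:- (con ⟦ + 6 ⟧ :* X)) :* (:- (con ⟦ + 3 ⟧ :* X :* X :+ con ⟦ + 4 ⟧ :* A))
       := con ⟦ + 4 ⟧ :* (Y :* Y :- (X :* X :* X :+ A :* X))) refl ⟦ x ⟧ ⟦ y ⟧ ⟦ a ⟧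

  curveEquation-ℚ : ∀ a b x y → y ℤ.* y ≡ x ℤ.* x ℤ.* x ℤ.+ a ℤ.* x ℤ.+ b →
                    ⟦ y ⟧ * ⟦ y ⟧ - (cube ⟦ x ⟧ + ⟦ a ⟧ * ⟦ x ⟧) ≡ ⟦ b ⟧
  curveEquation-ℚ a b x y onCurve = begin
    ⟦ y ⟧ * ⟦ y ⟧ - (cube ⟦ x ⟧ + ⟦ a ⟧ * ⟦ x ⟧)
      ≡⟨ cong (_- (cube ⟦ x ⟧ + ⟦ a ⟧ * ⟦ x ⟧)) y² ⟩
    cube ⟦ x ⟧ + ⟦ a ⟧ * ⟦ x ⟧ + ⟦ b ⟧ - (cube ⟦ x ⟧ + ⟦ a ⟧ * ⟦ x ⟧)
      ≡⟨ solve 3 (λ X A B → X :* X :* X :+ A :* X :+ B :- (X :* X :* X :+ A :* X) := B)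
                 refl ⟦ x ⟧ ⟦ a ⟧ ⟦ b ⟧ ⟩
    ⟦ b ⟧ ∎
    where
    y² : ⟦ y ⟧ * ⟦ y ⟧ ≡ cube ⟦ x ⟧ + ⟦ a ⟧ * ⟦ x ⟧ + ⟦ b ⟧
    y² rewrite sym (⟦⟧-homo-* y y) | onCurve
             | ⟦⟧-homo-+ (x ℤ.* x ℤ.* x ℤ.+ a ℤ.* x) b | ⟦⟧-homo-+ (x ℤ.* x ℤ.* x) (a ℤ.* x)
             | ⟦⟧-homo-* (x ℤ.* x) x | ⟦⟧-homo-* x x | ⟦⟧-homo-* a x = refl

  J₃-quarticOf-onCurve : ∀ a b x y → y ℤ.* y ≡ x ℤ.* x ℤ.* x ℤ.+ a ℤ.* x ℤ.+ b →
                         J₃ (quarticOf a x y) ≡ ⟦ + 4 ⟧ * ⟦ b ⟧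
  J₃-quarticOf-onCurve a b x y onCurve =
    trans (J₃-quarticOf a x y) (cong (⟦ + 4 ⟧ *_) (curveEquation-ℚ a b x y onCurve))

  H-quartic-of-invariants : ∀ Q a b →
    J₂ Q ≡ - (⟦ + 4 ⟧ * ⟦ a ⟧) → J₃ Q ≡ ⟦ + 4 ⟧ * ⟦ b ⟧ → H-quartic Q ≡ H-curve a b
  H-quartic-of-invariants Q a b J₂≡ J₃≡ = cong₂ _⊔_ J₂-term J₃-term
    where
    J₂-term : κ (2 ℕ.^ 6 ℕ.* 3 ℕ.^ 4) 1 * cube ∣ J₂ Q ∣ ≡ κ (2 ℕ.^ 12 ℕ.* 3 ℕ.^ 4) 1 * cube ∣ ⟦ a ⟧ ∣
    J₂-term = begin
      κ (2 ℕ.^ 6 ℕ.* 3 ℕ.^ 4) 1 * cube ∣ J₂ Q ∣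
        ≡⟨ cong (λ j → κ (2 ℕ.^ 6 ℕ.* 3 ℕ.^ 4) 1 * cube ∣ j ∣) J₂≡ ⟩
      κ (2 ℕ.^ 6 ℕ.* 3 ℕ.^ 4) 1 * cube ∣ - (⟦ + 4 ⟧ * ⟦ a ⟧) ∣
        ≡⟨ cong (λ j → κ (2 ℕ.^ 6 ℕ.* 3 ℕ.^ 4) 1 * cube j)
                (trans (∣-p∣≡∣p∣ (⟦ + 4 ⟧ * ⟦ a ⟧)) (∣p*q∣≡∣p∣*∣q∣ ⟦ + 4 ⟧ ⟦ a ⟧)) ⟩
      κ (2 ℕ.^ 6 ℕ.* 3 ℕ.^ 4) 1 * cube (⟦ + 4 ⟧ * ∣ ⟦ a ⟧ ∣)
        ≡⟨ solve 1 (λ Z → con (κ (2 ℕ.^ 6 ℕ.* 3 ℕ.^ 4) 1)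
                            :* ((con ⟦ + 4 ⟧ :* Z) :* (con ⟦ + 4 ⟧ :* Z) :* (con ⟦ + 4 ⟧ :* Z))
                         := con (κ (2 ℕ.^ 12 ℕ.* 3 ℕ.^ 4) 1) :* (Z :* Z :* Z)) refl ∣ ⟦ a ⟧ ∣ ⟩
      κ (2 ℕ.^ 12 ℕ.* 3 ℕ.^ 4) 1 * cube ∣ ⟦ a ⟧ ∣ ∎
    J₃-term : κ (2 ℕ.^ 10 ℕ.* 3 ℕ.^ 12) 1 * sq (J₃ Q) ≡ κ (2 ℕ.^ 14 ℕ.* 3 ℕ.^ 12) 1 * sq ⟦ b ⟧
    J₃-term = begin
      κ (2 ℕ.^ 10 ℕ.* 3 ℕ.^ 12) 1 * sq (J₃ Q)
        ≡⟨ cong (λ j → κ (2 ℕ.^ 10 ℕ.* 3 ℕ.^ 12) 1 * sq j) J₃≡ ⟩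
      κ (2 ℕ.^ 10 ℕ.* 3 ℕ.^ 12) 1 * sq (⟦ + 4 ⟧ * ⟦ b ⟧)
        ≡⟨ solve 1 (λ B → con (κ (2 ℕ.^ 10 ℕ.* 3 ℕ.^ 12) 1)
                            :* ((con ⟦ + 4 ⟧ :* B) :* (con ⟦ + 4 ⟧ :* B))
                         := con (κ (2 ℕ.^ 14 ℕ.* 3 ℕ.^ 12) 1) :* (B :* B)) refl ⟦ b ⟧ ⟩
      κ (2 ℕ.^ 14 ℕ.* 3 ℕ.^ 12) 1 * sq ⟦ b ⟧ ∎

open Invariants
open import Data.Integer using (_+_; _*_)

-- The discriminant hypothesis only makes Y_{a,b} an elliptic curve; the identity does not need it.
proposition6p2 : (a b : ℤ) → + 4 * a * a * a + + 27 * b * b ≢ + 0 →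
                 (xₜ yₜ : ℤ) → yₜ * yₜ ≡ xₜ * xₜ * xₜ + a * xₜ + b →
                 H-curve a b ≡ H-quartic (quarticOf a xₜ yₜ)
proposition6p2 a b _ xₜ yₜ onCurve =
  sym (H-quartic-of-invariants (quarticOf a xₜ yₜ) a b
         (J₂-quarticOf a xₜ yₜ)
         (J₃-quarticOf-onCurve a b xₜ yₜ onCurve))
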